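{- Let $\mathbb K$ be a field of characteristic $0$, $S=\mathbb K[x,y,z]$, and for a line arrangement with defining polynomial $F$ consider the derivations of the form $\theta=Q'\,y\frac{\partial}{\partial y}+R'\,z\frac{\partial}{\partial z}$ with $Q',R'\in S_1$ that are logarithmic for the arrangement. Then: \begin{itemize} \item[(I)] If $F=xyz(x+y)\prod_{j=4}^s(t_jy+z)$ with $s\ge 4$ and $t_4,\dots,t_s$ pairwise distinct and nonzero: for $s\ge5$ these derivations are exactly the scalar multiples of $(x+y)\left(y\frac{\partial}{\partial y}+z\frac{\partial}{\partial z}\right)$; for $s=4$ they are exactly $\alpha(x+y)\left(y\frac{\partial}{\partial y}+z\frac{\partial}{\partial z}\right)+\beta(t_4y+z)z\frac{\partial}{\partial z}$, $\alpha,\beta\in\mathbb K$. \item[(II)] If $F=xyz(x+y+z)\prod_{j=4}^s(t_jy+z)$ with $s\ge4$ and $t_4,\dots,t_s$ pairwise distinct and different from $0,1$: these derivations are exactly the scalar multiples of $(x+y+z)\left(y\frac{\partial}{\partial y}+z\frac{\partial}{\partial z}\right)$. \item[(III)] If $F=xyz(x+y+z)(x+z)(y+z)$: these derivations are exactly the scalar multiples of $(x+y+2z)y\frac{\partial}{\partial y}+(x+z)z\frac{\partial}{\partial z}$. \end{itemize}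
   Context: A line arrangement is given by its defining polynomial $F=l_1\cdots l_s$, a product of pairwise non-proportional linear forms in $S=\mathbb K[x,y,z]$. A derivation $\theta=P\partial_x+Q\partial_y+R\partial_z$ with $P,Q,R\in S$ is logarithmic for the arrangement if $\theta(l_i)\in\langle l_i\rangle$ (the principal ideal generated by $l_i$) for every $i$. -}

module Defs where

open import Level using (Level; _⊔_)
open import Algebra.Bundles using (CommutativeRing)
open import Data.Nat as ℕ using (ℕ; zero; suc)
open import Data.Nat.Properties using () renaming (_≟_ to _≟ℕ_)
open import Data.Bool using (Bool; true; false; _∧_; if_then_else_)
open import Relation.Nullary.Decidable using (⌊_⌋)
open import Relation.Nullary using (¬_)
open import Data.Product using (_×_; _,_; Σ; ∃)
open import Data.List using (List; []; _∷_; _++_; map; concatMap)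
open import Data.List.Relation.Unary.All using (All)
open import Data.Fin using (Fin)
open import Data.List using (allFin)

record Field (c ℓ : Level) : Set (Level.suc (c ⊔ ℓ)) where
  field
    commutativeRing : CommutativeRing c ℓ
  open CommutativeRing commutativeRing public
  field
    1≉0     : ¬ (1# ≈ 0#)
    inverse : ∀ a → ¬ (a ≈ 0#) → Σ Carrier (λ b → (a * b) ≈ 1#)

module Over {c ℓ : Level} (𝔽 : Field c ℓ) where
  open Field 𝔽

  fromℕ : ℕ → Carrier
  fromℕ zero    = 0#
  fromℕ (suc n) = 1# + fromℕ n

  CharZero : Set ℓ
  CharZero = ∀ n → ¬ (fromℕ (suc n) ≈ 0#)

  -- Polynomials in S = K[x,y,z]: finite lists of terms c·x^i y^j z^k
  -- (repetitions allowed), compared via their coefficient functions.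
  Term : Set c
  Term = Carrier × ℕ × ℕ × ℕ

  Poly : Set c
  Poly = List Term

  coeff : Poly → ℕ → ℕ → ℕ → Carrier
  coeff []                        i j k = 0#
  coeff ((a , i' , j' , k') ∷ p)  i j k =
    if ⌊ i ≟ℕ i' ⌋ ∧ ⌊ j ≟ℕ j' ⌋ ∧ ⌊ k ≟ℕ k' ⌋
    then a + coeff p i j k else coeff p i j k

  _≈ₚ_ : Poly → Poly → Set ℓ
  p ≈ₚ q = ∀ i j k → coeff p i j k ≈ coeff q i j k

  _+ₚ_ : Poly → Poly → Poly
  p +ₚ q = p ++ q

  _*ₚ_ : Poly → Poly → Poly
  p *ₚ q = concatMap (λ { (a , i , j , k) →
             map (λ { (b , i' , j' , k') → (a * b , i ℕ.+ i' , j ℕ.+ j' , k ℕ.+ k') }) q }) p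

  const : Carrier → Poly
  const a = (a , 0 , 0 , 0) ∷ []

  _∈⟨_⟩ : Poly → Poly → Set (c ⊔ ℓ)
  f ∈⟨ l ⟩ = ∃ λ (g : Poly) → f ≈ₚ (l *ₚ g)

  record Lin : Set c where
    constructor lin
    field
      cx cy cz : Carrier
  open Lin public

  linPoly : Lin → Poly
  linPoly l = (cx l , 1 , 0 , 0) ∷ (cy l , 0 , 1 , 0) ∷ (cz l , 0 , 0 , 1) ∷ []

  _≈L_ : Lin → Lin → Set ℓ
  l ≈L m = (cx l ≈ cx m) × (cy l ≈ cy m) × (cz l ≈ cz m)

  _+L_ : Lin → Lin → Lin
  l +L m = lin (cx l + cx m) (cy l + cy m) (cz l + cz m)

  _·L_ : Carrier → Lin → Lin
  a ·L l = lin (a * cx l) (a * cy l) (a * cz l)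

  X Y Z : Lin
  X = lin 1# 0# 0#
  Y = lin 0# 1# 0#
  Z = lin 0# 0# 1#

  -- Derivations θ = P ∂x + Q ∂y + R ∂z with P, Q, R ∈ S
  record Der : Set c where
    constructor der
    field
      P Q R : Poly

  applyLin : Der → Lin → Poly
  applyLin θ l = (Der.P θ *ₚ const (cx l)) +ₚ
                 ((Der.Q θ *ₚ const (cy l)) +ₚ (Der.R θ *ₚ const (cz l)))

  IsLogarithmic : Der → List Lin → Set (c ⊔ ℓ)
  IsLogarithmic θ A = All (λ l → applyLin θ l ∈⟨ linPoly l ⟩) A

  θyz : Lin → Lin → Der
  θyz Q' R' = der [] (linPoly Q' *ₚ linPoly Y) (linPoly R' *ₚ linPoly Z)

  tyz : Carrier → Lin
  tyz t = lin 0# t 1#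

  -- (I)  F = x y z (x+y) ∏_{j=4}^s (t_j y + z),  t indexed by Fin (s ∸ 3)
  arrI : (s : ℕ) → (Fin (s ℕ.∸ 3) → Carrier) → List Lin
  arrI s t = X ∷ Y ∷ Z ∷ lin 1# 1# 0# ∷ map (λ j → tyz (t j)) (allFin (s ℕ.∸ 3))

  arrII : (s : ℕ) → (Fin (s ℕ.∸ 3) → Carrier) → List Lin
  arrII s t = X ∷ Y ∷ Z ∷ lin 1# 1# 1# ∷ map (λ j → tyz (t j)) (allFin (s ℕ.∸ 3))

  arrIII : List Lin
  arrIII = X ∷ Y ∷ Z ∷ lin 1# 1# 1# ∷ lin 1# 0# 1# ∷ lin 0# 1# 1# ∷ []

-- For θ = Q' y∂y + R' z∂z and a line l = a x + b y + c z, θ(l) = b y Q' + c z R' is a quadratic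
-- form, so θ(l) ∈ ⟨l⟩ means that its six coefficients are those of l·m for a linear form m.
-- The coordinate lines impose nothing. For a line x + b y + c z the quotient m is read off from
-- the coefficients of x², xy, xz, for τ y + z (τ ≠ 0) from those of xy, xz, y², z²; the remaining
-- coefficients give two or three linear equations in the six coefficients of Q' and R'. In (I) the
-- z-coefficient of R' survives one line t y + z but is killed by two distinct ones; in (II) a
-- single line t y + z with t ≠ 1 already leaves only the multiples of x + y + z.
module Submission where

open import Level using (Level; _⊔_)
open import Data.Bool using (true; false; _∧_; if_then_else_)
open import Data.Bool.Properties using (∧-zeroʳ)
open import Data.Nat using (ℕ; zero; suc; _≡ᵇ_; _≤_; _∸_; s≤s; z≤n)
import Data.Nat.Properties as ℕ
open import Data.Fin using (Fin)
import Data.Fin as Fin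
open import Data.Fin.Properties using (0≢1+n)
open import Data.List using ([]; _∷_; _++_; map; allFin)
open import Data.List.Properties using (++-identityʳ)
open import Data.List.Relation.Unary.All as All using (All; []; _∷_)
open import Data.List.Relation.Unary.All.Properties using (map⁺; map⁻; tabulate⁺; tabulate⁻)
open import Data.Product using (_×_; _,_; ∃; ∃₂)
open import Data.Product.Function.NonDependent.Propositional using (_×-⇔_)
open import Function.Bundles using (_⇔_; mk⇔; Equivalence)
import Function.Properties.Equivalence as ⇔
open import Relation.Nullary using (¬_)
open import Relation.Nullary.Decidable using (isYes≗does)
open import Relation.Binary.PropositionalEquality as ≡ using (_≡_)
open import Defs

All-∷-map-allFin⇔ : ∀ {a p} {A : Set a} {P : A → Set p} x {n} (f : Fin n → A) →
                    All P (x ∷ map f (allFin n)) ⇔ (P x × (∀ j → P (f j)))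
All-∷-map-allFin⇔ x f =
  mk⇔ (λ { (px ∷ pf) → px , tabulate⁻ (map⁻ pf) }) (λ (px , pf) → px ∷ map⁺ (tabulate⁺ pf))

module LineArrangements {c ℓ : Level} (𝔽 : Field c ℓ) where
  open Field 𝔽 hiding (zero)
  open Over 𝔽
  open import Algebra.Properties.CommutativeSemigroup +-commutativeSemigroup using (x∙yz≈y∙xz)
  open import Algebra.Properties.Ring ring using (+-cancelˡ; +-cancelʳ; x∙y⁻¹≈ε⇒x≈y)
  open import Algebra.Solver.Ring.NaturalCoefficients.Default commutativeSemiring
    using (solve; _:+_; _:*_; _:=_; con)
  open import Relation.Binary.Reasoning.Setoid setoid

  *-cancelˡ-nonZero : ∀ {a x y} → ¬ a ≈ 0# → a * x ≈ a * y → x ≈ y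
  *-cancelˡ-nonZero {a} {x} {y} a≉0 ax≈ay with inverse a a≉0
  ... | a⁻¹ , aa⁻¹≈1 = begin
    x              ≈⟨ unit x ⟨
    a⁻¹ * (a * x)  ≈⟨ *-congˡ ax≈ay ⟩
    a⁻¹ * (a * y)  ≈⟨ unit y ⟩
    y              ∎
    where
    unit : ∀ z → a⁻¹ * (a * z) ≈ z
    unit z = trans (sym (*-assoc a⁻¹ a z))
                   (trans (*-congʳ (trans (*-comm a⁻¹ a) aa⁻¹≈1)) (*-identityˡ z))

  -- (τ - σ) (x - y) = 0 with both sides moved so that no subtraction occurs.
  distinct-cancel : ∀ {τ σ x y} → ¬ τ ≈ σ → τ * x + σ * y ≈ σ * x + τ * y → x ≈ y
  distinct-cancel {τ} {σ} {x} {y} τ≉σ τx+σy≈σx+τy =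
    *-cancelˡ-nonZero τ-σ≉0 (+-cancelʳ (σ * x + σ * y) _ _ (begin
      (τ - σ) * x + (σ * x + σ * y)  ≈⟨ shift x y ⟩
      τ * x + σ * y                  ≈⟨ τx+σy≈σx+τy ⟩
      σ * x + τ * y                  ≈⟨ +-comm _ _ ⟩
      τ * y + σ * x                  ≈⟨ shift y x ⟨
      (τ - σ) * y + (σ * y + σ * x)  ≈⟨ +-congˡ (+-comm _ _) ⟩
      (τ - σ) * y + (σ * x + σ * y)  ∎))
    where
    τ-σ≉0 : ¬ (τ - σ) ≈ 0#
    τ-σ≉0 τ-σ≈0 = τ≉σ (x∙y⁻¹≈ε⇒x≈y τ σ τ-σ≈0)
    shift : ∀ u v → (τ - σ) * u + (σ * u + σ * v) ≈ τ * u + σ * v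
    shift u v = begin
      (τ + - σ) * u + (σ * u + σ * v)
        ≈⟨ solve 5 (λ τ n σ u v → (τ :+ n) :* u :+ (σ :* u :+ σ :* v)
                                  := τ :* u :+ (n :+ σ) :* u :+ σ :* v) refl τ (- σ) σ u v ⟩
      τ * u + (- σ + σ) * u + σ * v
        ≈⟨ +-congʳ (+-congˡ (trans (*-congʳ (-‿inverseˡ σ)) (zeroˡ u))) ⟩
      τ * u + 0# + σ * v               ≈⟨ +-congʳ (+-identityʳ _) ⟩
      τ * u + σ * v                    ∎

  1*v+d*u≈v : ∀ d {u v} → u ≈ 0# → 1# * v + d * u ≈ v
  1*v+d*u≈v d {u} {v} u≈0 =
    trans (+-cong (*-identityˡ v) (trans (*-congˡ u≈0) (zeroʳ d))) (+-identityʳ v)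

  0*u+v≈v : ∀ u v → 0# * u + v ≈ v
  0*u+v≈v u v = trans (+-congʳ (zeroˡ u)) (+-identityˡ v)

  0*u≈0*v : ∀ u v → 0# * u ≈ 0# * v
  0*u≈0*v u v = trans (zeroˡ u) (sym (zeroˡ v))

  1*[1*u]≈u : ∀ u → 1# * (1# * u) ≈ u
  1*[1*u]≈u u = trans (*-identityˡ _) (*-identityˡ u)

  x≈α⇒x≈α*1 : ∀ {x α} → x ≈ α → x ≈ α * 1#
  x≈α⇒x≈α*1 x≈α = trans x≈α (sym (*-identityʳ _))

  x≈0⇒x≈α*0 : ∀ {x} α → x ≈ 0# → x ≈ α * 0#
  x≈0⇒x≈α*0 α x≈0 = trans x≈0 (sym (zeroʳ α))

  ≈-⇔ : ∀ {x x' y y'} → x ≈ x' → y ≈ y' → (x ≈ y) ⇔ (x' ≈ y')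
  ≈-⇔ x≈x' y≈y' =
    mk⇔ (λ x≈y → trans (sym x≈x') (trans x≈y y≈y'))
        (λ x'≈y' → trans x≈x' (trans x'≈y' (sym y≈y')))

  -- Coefficients of polynomials

  -- Unlike the function type that _≈ₚ_ unfolds to, this record lets Agda infer both polynomials.
  record _≋_ (p q : Poly) : Set ℓ where
    constructor pointwise
    field coeff≈ : p ≈ₚ q
  open _≋_

  ≋-refl : ∀ {p} → p ≋ p
  ≋-refl = pointwise λ i j k → refl

  ≋-sym : ∀ {p q} → p ≋ q → q ≋ p
  ≋-sym (pointwise p≈q) = pointwise λ i j k → sym (p≈q i j k)

  ≋-trans : ∀ {p q r} → p ≋ q → q ≋ r → p ≋ r
  ≋-trans (pointwise p≈q) (pointwise q≈r) = pointwise λ i j k → trans (p≈q i j k) (q≈r i j k)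

  -- Unlike ⌊ i ≟ i' ⌋, the test i ≡ᵇ i' computes when both sides are successors.
  coeff-∷ : ∀ a i' j' k' p i j k → coeff ((a , i' , j' , k') ∷ p) i j k ≡
    (if (i ≡ᵇ i') ∧ (j ≡ᵇ j') ∧ (k ≡ᵇ k') then a + coeff p i j k else coeff p i j k)
  coeff-∷ a i' j' k' p i j k
    rewrite isYes≗does (i ℕ.≟ i') | isYes≗does (j ℕ.≟ j') | isYes≗does (k ℕ.≟ k') = ≡.refl

  ∷-cong : ∀ {a b i' j' k' p q} → a ≈ b → p ≋ q → ((a , i' , j' , k') ∷ p) ≋ ((b , i' , j' , k') ∷ q)
  ∷-cong {a} {b} {i'} {j'} {k'} {p} {q} a≈b (pointwise p≈q) = pointwise heads
    where
    heads : ((a , i' , j' , k') ∷ p) ≈ₚ ((b , i' , j' , k') ∷ q)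
    heads i j k rewrite coeff-∷ a i' j' k' p i j k | coeff-∷ b i' j' k' q i j k
      with (i ≡ᵇ i') ∧ (j ≡ᵇ j') ∧ (k ≡ᵇ k')
    ... | true  = +-cong a≈b (p≈q i j k)
    ... | false = p≈q i j k

  ∷-congʳ : ∀ t {p q} → p ≋ q → (t ∷ p) ≋ (t ∷ q)
  ∷-congʳ (a , i , j , k) = ∷-cong refl

  ∷-swap : ∀ s t p → (s ∷ t ∷ p) ≋ (t ∷ s ∷ p)
  ∷-swap s@(a , i₁ , j₁ , k₁) t@(b , i₂ , j₂ , k₂) p = pointwise swapped
    where
    swapped : (s ∷ t ∷ p) ≈ₚ (t ∷ s ∷ p)
    swapped i j k
      rewrite coeff-∷ a i₁ j₁ k₁ (t ∷ p) i j k | coeff-∷ b i₂ j₂ k₂ p i j k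
            | coeff-∷ b i₂ j₂ k₂ (s ∷ p) i j k | coeff-∷ a i₁ j₁ k₁ p i j k
      with (i ≡ᵇ i₁) ∧ (j ≡ᵇ j₁) ∧ (k ≡ᵇ k₁) | (i ≡ᵇ i₂) ∧ (j ≡ᵇ j₂) ∧ (k ≡ᵇ k₂)
    ... | true  | true  = x∙yz≈y∙xz a b _
    ... | true  | false = refl
    ... | false | true  = refl
    ... | false | false = refl

  ∷-merge : ∀ a b i' j' k' p →
            ((a , i' , j' , k') ∷ (b , i' , j' , k') ∷ p) ≋ ((a + b , i' , j' , k') ∷ p)
  ∷-merge a b i' j' k' p = pointwise merged
    where
    merged : ((a , i' , j' , k') ∷ (b , i' , j' , k') ∷ p) ≈ₚ ((a + b , i' , j' , k') ∷ p)
    merged i j k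
      rewrite coeff-∷ a i' j' k' ((b , i' , j' , k') ∷ p) i j k | coeff-∷ b i' j' k' p i j k
            | coeff-∷ (a + b) i' j' k' p i j k
      with (i ≡ᵇ i') ∧ (j ≡ᵇ j') ∧ (k ≡ᵇ k')
    ... | true  = sym (+-assoc a b _)
    ... | false = refl

  coeff-++ : ∀ p q i j k → coeff (p +ₚ q) i j k ≈ coeff p i j k + coeff q i j k
  coeff-++ [] q i j k = sym (+-identityˡ _)
  coeff-++ ((a , i' , j' , k') ∷ p) q i j k
    rewrite coeff-∷ a i' j' k' (p ++ q) i j k | coeff-∷ a i' j' k' p i j k
    with (i ≡ᵇ i') ∧ (j ≡ᵇ j') ∧ (k ≡ᵇ k')
  ... | true  = trans (+-congˡ (coeff-++ p q i j k)) (sym (+-assoc _ _ _))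
  ... | false = coeff-++ p q i j k

  ∷-*ʳ : ∀ {a b i' j' k' p' p} i j k → coeff p' i j k ≈ coeff p i j k * a →
         coeff ((b * a , i' , j' , k') ∷ p') i j k ≈ coeff ((b , i' , j' , k') ∷ p) i j k * a
  ∷-*ʳ {a} {b} {i'} {j'} {k'} {p'} {p} i j k p'≈pa
    rewrite coeff-∷ (b * a) i' j' k' p' i j k | coeff-∷ b i' j' k' p i j k
    with (i ≡ᵇ i') ∧ (j ≡ᵇ j') ∧ (k ≡ᵇ k')
  ... | true  = trans (+-congˡ p'≈pa) (sym (distribʳ a b _))
  ... | false = p'≈pa

  coeff-*const : ∀ p a i j k → coeff (p *ₚ const a) i j k ≈ coeff p i j k * a
  coeff-*const [] a i j k = sym (zeroˡ a)
  coeff-*const ((b , i' , j' , k') ∷ p) a i j k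
    rewrite ℕ.+-identityʳ i' | ℕ.+-identityʳ j' | ℕ.+-identityʳ k' =
    ∷-*ʳ {p' = p *ₚ const a} {p} i j k (coeff-*const p a i j k)

  mulX mulY mulZ : Carrier → Term → Term
  mulX a (b , i , j , k) = a * b , suc i , j , k
  mulY a (b , i , j , k) = a * b , i , suc j , k
  mulZ a (b , i , j , k) = a * b , i , j , suc k

  coeff[x·_] coeff[y·_] coeff[z·_] : Poly → ℕ → ℕ → ℕ → Carrier
  coeff[x· g ] zero    j k = 0#
  coeff[x· g ] (suc i) j k = coeff g i j k
  coeff[y· g ] i zero    k = 0#
  coeff[y· g ] i (suc j) k = coeff g i j k
  coeff[z· g ] i j zero    = 0#
  coeff[z· g ] i j (suc k) = coeff g i j k

  coeff-map-mulX : ∀ a g i j k → coeff (map (mulX a) g) i j k ≈ a * coeff[x· g ] i j k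
  coeff-map-mulX a [] zero    j k = sym (zeroʳ a)
  coeff-map-mulX a [] (suc i) j k = sym (zeroʳ a)
  coeff-map-mulX a (_ ∷ g) zero j k = coeff-map-mulX a g zero j k
  coeff-map-mulX a ((b , i' , j' , k') ∷ g) (suc i) j k
    rewrite coeff-∷ (a * b) (suc i') j' k' (map (mulX a) g) (suc i) j k | coeff-∷ b i' j' k' g i j k
    with (i ≡ᵇ i') ∧ (j ≡ᵇ j') ∧ (k ≡ᵇ k')
  ... | true  = trans (+-congˡ (coeff-map-mulX a g (suc i) j k)) (sym (distribˡ a b _))
  ... | false = coeff-map-mulX a g (suc i) j k

  coeff-map-mulY : ∀ a g i j k → coeff (map (mulY a) g) i j k ≈ a * coeff[y· g ] i j k
  coeff-map-mulY a [] i zero    k = sym (zeroʳ a)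
  coeff-map-mulY a [] i (suc j) k = sym (zeroʳ a)
  coeff-map-mulY a ((b , i' , j' , k') ∷ g) i zero k
    rewrite coeff-∷ (a * b) i' (suc j') k' (map (mulY a) g) i zero k | ∧-zeroʳ (i ≡ᵇ i') =
    coeff-map-mulY a g i zero k
  coeff-map-mulY a ((b , i' , j' , k') ∷ g) i (suc j) k
    rewrite coeff-∷ (a * b) i' (suc j') k' (map (mulY a) g) i (suc j) k | coeff-∷ b i' j' k' g i j k
    with (i ≡ᵇ i') ∧ (j ≡ᵇ j') ∧ (k ≡ᵇ k')
  ... | true  = trans (+-congˡ (coeff-map-mulY a g i (suc j) k)) (sym (distribˡ a b _))
  ... | false = coeff-map-mulY a g i (suc j) k

  coeff-map-mulZ : ∀ a g i j k → coeff (map (mulZ a) g) i j k ≈ a * coeff[z· g ] i j k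
  coeff-map-mulZ a [] i j zero    = sym (zeroʳ a)
  coeff-map-mulZ a [] i j (suc k) = sym (zeroʳ a)
  coeff-map-mulZ a ((b , i' , j' , k') ∷ g) i j zero
    rewrite coeff-∷ (a * b) i' j' (suc k') (map (mulZ a) g) i j zero
          | ∧-zeroʳ (j ≡ᵇ j') | ∧-zeroʳ (i ≡ᵇ i') =
    coeff-map-mulZ a g i j zero
  coeff-map-mulZ a ((b , i' , j' , k') ∷ g) i j (suc k)
    rewrite coeff-∷ (a * b) i' j' (suc k') (map (mulZ a) g) i j (suc k) | coeff-∷ b i' j' k' g i j k
    with (i ≡ᵇ i') ∧ (j ≡ᵇ j') ∧ (k ≡ᵇ k')
  ... | true  = trans (+-congˡ (coeff-map-mulZ a g i j (suc k))) (sym (distribˡ a b _))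
  ... | false = coeff-map-mulZ a g i j (suc k)

  coeff-linPoly-* : ∀ l g i j k → coeff (linPoly l *ₚ g) i j k ≈
    cx l * coeff[x· g ] i j k + (cy l * coeff[y· g ] i j k + cz l * coeff[z· g ] i j k)
  coeff-linPoly-* l g i j k = begin
    coeff (xg ++ (yg ++ (zg ++ []))) i j k                     ≈⟨ coeff-++ xg _ i j k ⟩
    coeff xg i j k + coeff (yg ++ (zg ++ [])) i j k             ≈⟨ +-congˡ (coeff-++ yg _ i j k) ⟩
    coeff xg i j k + (coeff yg i j k + coeff (zg ++ []) i j k)
      ≡⟨ ≡.cong (λ r → coeff xg i j k + (coeff yg i j k + coeff r i j k)) (++-identityʳ zg) ⟩
    coeff xg i j k + (coeff yg i j k + coeff zg i j k)
      ≈⟨ +-cong (coeff-map-mulX (cx l) g i j k)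
                (+-cong (coeff-map-mulY (cy l) g i j k) (coeff-map-mulZ (cz l) g i j k)) ⟩
    cx l * coeff[x· g ] i j k + (cy l * coeff[y· g ] i j k + cz l * coeff[z· g ] i j k) ∎
    where
    xg yg zg : Poly
    xg = map (mulX (cx l)) g
    yg = map (mulY (cy l)) g
    zg = map (mulZ (cz l)) g

  data Combination (a b : Carrier) : Poly → Poly → Poly → Set (c ⊔ ℓ) where
    []  : Combination a b [] [] []
    _∷_ : ∀ {x y z i j k p q r} → x * a + y * b ≈ z → Combination a b p q r →
          Combination a b ((x , i , j , k) ∷ p) ((y , i , j , k) ∷ q) ((z , i , j , k) ∷ r)

  coeff-combination : ∀ {a b p q r} → Combination a b p q r →
                      ∀ i j k → coeff p i j k * a + coeff q i j k * b ≈ coeff r i j k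
  coeff-combination {a} {b} [] i j k = trans (+-cong (zeroˡ a) (zeroˡ b)) (+-identityˡ 0#)
  coeff-combination {a} {b} (_∷_ {x} {y} {z} {i'} {j'} {k'} {p} {q} {r} xa+yb≈z comb) i j k
    rewrite coeff-∷ x i' j' k' p i j k | coeff-∷ y i' j' k' q i j k | coeff-∷ z i' j' k' r i j k
    with (i ≡ᵇ i') ∧ (j ≡ᵇ j') ∧ (k ≡ᵇ k')
  ... | true  = begin
    (x + coeff p i j k) * a + (y + coeff q i j k) * b
      ≈⟨ solve 6 (λ x y a b P Q → (x :+ P) :* a :+ (y :+ Q) :* b := (x :* a :+ y :* b) :+ (P :* a :+ Q :* b))
               refl x y a b (coeff p i j k) (coeff q i j k) ⟩
    (x * a + y * b) + (coeff p i j k * a + coeff q i j k * b)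
      ≈⟨ +-cong xa+yb≈z (coeff-combination comb i j k) ⟩
    z + coeff r i j k ∎
  ... | false = coeff-combination comb i j k

  -- Quadratic forms

  record Quad : Set c where
    constructor quad
    field cx² cxy cxz cy² cyz cz² : Carrier
  open Quad

  toPoly : Quad → Poly
  toPoly q = (cx² q , 2 , 0 , 0) ∷ (cxy q , 1 , 1 , 0) ∷ (cxz q , 1 , 0 , 1) ∷
             (cy² q , 0 , 2 , 0) ∷ (cyz q , 0 , 1 , 1) ∷ (cz² q , 0 , 0 , 2) ∷ []

  _≈Q_ : Quad → Quad → Set ℓ
  q ≈Q r = (cx² q ≈ cx² r) × (cxy q ≈ cxy r) × (cxz q ≈ cxz r) ×
           (cy² q ≈ cy² r) × (cyz q ≈ cyz r) × (cz² q ≈ cz² r)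

  ≈Q-trans : ∀ {q r s} → q ≈Q r → r ≈Q s → q ≈Q s
  ≈Q-trans (e₁ , e₂ , e₃ , e₄ , e₅ , e₆) (f₁ , f₂ , f₃ , f₄ , f₅ , f₆) =
    trans e₁ f₁ , trans e₂ f₂ , trans e₃ f₃ , trans e₄ f₄ , trans e₅ f₅ , trans e₆ f₆

  toPoly-cong : ∀ {q r} → q ≈Q r → toPoly q ≋ toPoly r
  toPoly-cong (e₁ , e₂ , e₃ , e₄ , e₅ , e₆) =
    ∷-cong e₁ (∷-cong e₂ (∷-cong e₃ (∷-cong e₄ (∷-cong e₅ (∷-cong e₆ ≋-refl)))))

  _⊗_ : Lin → Lin → Quad
  a ⊗ b = quad (cx a * cx b) (cx a * cy b + cy a * cx b) (cx a * cz b + cz a * cx b)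
               (cy a * cy b) (cy a * cz b + cz a * cy b) (cz a * cz b)

  -- The nine products of terms are sorted into the order x², xy, xz, y², yz, z² and merged.
  linPoly-*ₚ-linPoly : ∀ a b → (linPoly a *ₚ linPoly b) ≋ toPoly (a ⊗ b)
  linPoly-*ₚ-linPoly a b =
    ≋-trans (∷-congʳ _ (∷-congʳ _ (∷-swap _ _ _))) (
    ≋-trans (∷-congʳ _ (∷-merge _ _ _ _ _ _)) (
    ≋-trans (∷-congʳ _ (∷-congʳ _ (∷-congʳ _ (∷-congʳ _ (∷-swap _ _ _))))) (
    ≋-trans (∷-congʳ _ (∷-congʳ _ (∷-congʳ _ (∷-swap _ _ _)))) (
    ≋-trans (∷-congʳ _ (∷-congʳ _ (∷-merge _ _ _ _ _ _)))
            (∷-congʳ _ (∷-congʳ _ (∷-congʳ _ (∷-congʳ _ (∷-merge _ _ _ _ _ _)))))))))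

  _∣Q_ : Lin → Quad → Set (c ⊔ ℓ)
  l ∣Q q = ∃ λ m → q ≈Q (l ⊗ m)

  ∈⟨⟩-resp-≋ : ∀ {p p'} l → p ≋ p' → p ∈⟨ l ⟩ → p' ∈⟨ l ⟩
  ∈⟨⟩-resp-≋ _ (pointwise p≈p') (g , p≈lg) = g , λ i j k → trans (sym (p≈p' i j k)) (p≈lg i j k)

  toPoly∈⟨⟩⇔∣Q : ∀ l q → toPoly q ∈⟨ linPoly l ⟩ ⇔ l ∣Q q
  toPoly∈⟨⟩⇔∣Q l q = mk⇔ linear-quotient multiple
    where
    multiple : l ∣Q q → toPoly q ∈⟨ linPoly l ⟩
    multiple (m , q≈lm) = linPoly m , coeff≈ (≋-trans (toPoly-cong q≈lm) (≋-sym (linPoly-*ₚ-linPoly l m)))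

    linear-quotient : toPoly q ∈⟨ linPoly l ⟩ → l ∣Q q
    linear-quotient (g , q≈lg) = lin u v w ,
      read 2 0 0 ≡.refl (solve 4 (λ a u b c → a :* u :+ (b :* con 0 :+ c :* con 0) := a :* u)
                                 refl lx u ly lz) ,
      read 1 1 0 ≡.refl (solve 5 (λ a u v b c → a :* v :+ (b :* u :+ c :* con 0) := a :* v :+ b :* u)
                                 refl lx u v ly lz) ,
      read 1 0 1 ≡.refl (solve 5 (λ a u w b c → a :* w :+ (b :* con 0 :+ c :* u) := a :* w :+ c :* u)
                                 refl lx u w ly lz) ,
      read 0 2 0 ≡.refl (solve 4 (λ a v b c → a :* con 0 :+ (b :* v :+ c :* con 0) := b :* v)
                                 refl lx v ly lz) ,
      read 0 1 1 ≡.refl (solve 5 (λ a v w b c → a :* con 0 :+ (b :* w :+ c :* v) := b :* w :+ c :* v)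
                                 refl lx v w ly lz) ,
      read 0 0 2 ≡.refl (solve 4 (λ a w b c → a :* con 0 :+ (b :* con 0 :+ c :* w) := c :* w)
                                 refl lx w ly lz)
      where
      lx ly lz u v w : Carrier
      lx = cx l ; ly = cy l ; lz = cz l
      u = coeff g 1 0 0 ; v = coeff g 0 1 0 ; w = coeff g 0 0 1
      read : ∀ i j k {x r} → coeff (toPoly q) i j k ≡ x + 0# →
             lx * coeff[x· g ] i j k + (ly * coeff[y· g ] i j k + lz * coeff[z· g ] i j k) ≈ r → x ≈ r
      read i j k {x} {r} coeff≡x+0 e = begin
        x                             ≈⟨ +-identityʳ x ⟨
        x + 0#                        ≡⟨ coeff≡x+0 ⟨
        coeff (toPoly q) i j k        ≈⟨ q≈lg i j k ⟩
        coeff (linPoly l *ₚ g) i j k  ≈⟨ coeff-linPoly-* l g i j k ⟩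
        lx * coeff[x· g ] i j k + (ly * coeff[y· g ] i j k + lz * coeff[z· g ] i j k)  ≈⟨ e ⟩
        r                             ∎

  -- Lines along which θ is logarithmic

  θ : Lin → Lin → Lin → Quad
  θ Q R l = quad 0# (cy l * cx Q) (cz l * cx R) (cy l * cy Q) (cy l * cz Q + cz l * cy R) (cz l * cz R)

  θ-combination : ∀ Q R l → Combination (cy l) (cz l) (toPoly (Q ⊗ Y)) (toPoly (R ⊗ Z)) (toPoly (θ Q R l))
  θ-combination Q R l =
    solve 4 (λ qx rx b c → qx :* con 0 :* b :+ rx :* con 0 :* c := con 0)
      refl (cx Q) (cx R) (cy l) (cz l) ∷
    solve 6 (λ qx qy rx ry b c → (qx :* con 1 :+ qy :* con 0) :* b :+ (rx :* con 0 :+ ry :* con 0) :* c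
                                  := b :* qx)
      refl (cx Q) (cy Q) (cx R) (cy R) (cy l) (cz l) ∷
    solve 6 (λ qx qz rx rz b c → (qx :* con 0 :+ qz :* con 0) :* b :+ (rx :* con 1 :+ rz :* con 0) :* c
                                  := c :* rx)
      refl (cx Q) (cz Q) (cx R) (cz R) (cy l) (cz l) ∷
    solve 4 (λ qy ry b c → qy :* con 1 :* b :+ ry :* con 0 :* c := b :* qy)
      refl (cy Q) (cy R) (cy l) (cz l) ∷
    solve 6 (λ qy qz ry rz b c → (qy :* con 0 :+ qz :* con 1) :* b :+ (ry :* con 1 :+ rz :* con 0) :* c
                                  := b :* qz :+ c :* ry)
      refl (cy Q) (cz Q) (cy R) (cz R) (cy l) (cz l) ∷
    solve 4 (λ qz rz b c → qz :* con 0 :* b :+ rz :* con 1 :* c := c :* rz)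
      refl (cz Q) (cz R) (cy l) (cz l) ∷
    []

  θyz-toPoly : ∀ Q R l → applyLin (θyz Q R) l ≋ toPoly (θ Q R l)
  θyz-toPoly Q R l = pointwise coeff-θ
    where
    QY RZ : Poly
    QY = linPoly Q *ₚ linPoly Y
    RZ = linPoly R *ₚ linPoly Z
    coeff-θ : applyLin (θyz Q R) l ≈ₚ toPoly (θ Q R l)
    coeff-θ i j k = begin
      coeff ((QY *ₚ const (cy l)) +ₚ (RZ *ₚ const (cz l))) i j k
        ≈⟨ coeff-++ (QY *ₚ const (cy l)) (RZ *ₚ const (cz l)) i j k ⟩
      coeff (QY *ₚ const (cy l)) i j k + coeff (RZ *ₚ const (cz l)) i j k
        ≈⟨ +-cong (coeff-*const QY (cy l) i j k) (coeff-*const RZ (cz l) i j k) ⟩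
      coeff QY i j k * cy l + coeff RZ i j k * cz l
        ≈⟨ +-cong (*-congʳ (coeff≈ (linPoly-*ₚ-linPoly Q Y) i j k))
                  (*-congʳ (coeff≈ (linPoly-*ₚ-linPoly R Z) i j k)) ⟩
      coeff (toPoly (Q ⊗ Y)) i j k * cy l + coeff (toPoly (R ⊗ Z)) i j k * cz l
        ≈⟨ coeff-combination (θ-combination Q R l) i j k ⟩
      coeff (toPoly (θ Q R l)) i j k ∎

  LogarithmicAlong : Lin → Lin → Lin → Set (c ⊔ ℓ)
  LogarithmicAlong Q R l = l ∣Q θ Q R l

  θyz∈⟨⟩⇔logarithmicAlong : ∀ Q R l → applyLin (θyz Q R) l ∈⟨ linPoly l ⟩ ⇔ LogarithmicAlong Q R l
  θyz∈⟨⟩⇔logarithmicAlong Q R l = ⇔.trans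
    (mk⇔ (∈⟨⟩-resp-≋ (linPoly l) (θyz-toPoly Q R l))
         (∈⟨⟩-resp-≋ (linPoly l) (≋-sym (θyz-toPoly Q R l))))
    (toPoly∈⟨⟩⇔∣Q l (θ Q R l))

  isLogarithmic⇔ : ∀ Q R A → IsLogarithmic (θyz Q R) A ⇔ All (LogarithmicAlong Q R) A
  isLogarithmic⇔ Q R A = mk⇔ (All.map (Equivalence.to (θyz∈⟨⟩⇔logarithmicAlong Q R _)))
                             (All.map (Equivalence.from (θyz∈⟨⟩⇔logarithmicAlong Q R _)))

  θ-cong : ∀ {Q Q' R R'} l → Q ≈L Q' → R ≈L R' → θ Q R l ≈Q θ Q' R' l
  θ-cong l (qx , qy , qz) (rx , ry , rz) =
    refl , *-congˡ qx , *-congˡ rx , *-congˡ qy , +-cong (*-congˡ qz) (*-congˡ ry) , *-congˡ rz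

  logarithmicAlong-transport : ∀ {Q Q' R R'} l → Q ≈L Q' → R ≈L R' →
                               LogarithmicAlong Q' R' l → LogarithmicAlong Q R l
  logarithmicAlong-transport l Q≈Q' R≈R' (m , e) = m , ≈Q-trans (θ-cong l Q≈Q' R≈R') e

  logarithmicAlong-x+by+cz⇔ : ∀ Q R b c → LogarithmicAlong Q R (lin 1# b c) ⇔
    ((b * cy Q ≈ b * (b * cx Q)) ×
     (b * cz Q + c * cy R ≈ b * (c * cx R) + c * (b * cx Q)) ×
     (c * cz R ≈ c * (c * cx R)))
  logarithmicAlong-x+by+cz⇔ Q R b c = mk⇔ conditions quotient
    where
    Conditions : Set ℓ
    Conditions = (b * cy Q ≈ b * (b * cx Q)) ×
                 (b * cz Q + c * cy R ≈ b * (c * cx R) + c * (b * cx Q)) ×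
                 (c * cz R ≈ c * (c * cx R))
    conditions : LogarithmicAlong Q R (lin 1# b c) → Conditions
    conditions (lin u v w , 0≈u , bqx≈v+bu , crx≈w+cu , e₃ , e₄ , e₅) =
      trans e₃ (*-congˡ v≈bqx) ,
      trans e₄ (+-cong (*-congˡ w≈crx) (*-congˡ v≈bqx)) ,
      trans e₅ (*-congˡ w≈crx)
      where
      u≈0 : u ≈ 0#
      u≈0 = trans (sym (*-identityˡ u)) (sym 0≈u)
      v≈bqx : v ≈ b * cx Q
      v≈bqx = sym (trans bqx≈v+bu (1*v+d*u≈v b u≈0))
      w≈crx : w ≈ c * cx R
      w≈crx = sym (trans crx≈w+cu (1*v+d*u≈v c u≈0))
    quotient : Conditions → LogarithmicAlong Q R (lin 1# b c)
    quotient (e₃ , e₄ , e₅) = lin 0# (b * cx Q) (c * cx R) ,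
      sym (*-identityˡ 0#) , sym (1*v+d*u≈v b refl) , sym (1*v+d*u≈v c refl) , e₃ , e₄ , e₅

  logarithmicAlong-τy+z⇔ : ∀ Q R τ → ¬ τ ≈ 0# → LogarithmicAlong Q R (tyz τ) ⇔
    ((cx Q ≈ cx R) × (τ * cz Q + cy R ≈ τ * cz R + cy Q))
  logarithmicAlong-τy+z⇔ Q R τ τ≉0 = mk⇔ conditions quotient
    where
    Conditions : Set ℓ
    Conditions = (cx Q ≈ cx R) × (τ * cz Q + cy R ≈ τ * cz R + cy Q)
    conditions : LogarithmicAlong Q R (tyz τ) → Conditions
    conditions (lin u v w , _ , τqx≈0v+τu , 1rx≈0w+1u , τqy≈τv , e₄ , 1rz≈1w) =
      trans qx≈u (sym rx≈u) , (begin
        τ * cz Q + cy R       ≈⟨ +-congˡ (*-identityˡ _) ⟨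
        τ * cz Q + 1# * cy R  ≈⟨ e₄ ⟩
        τ * w + 1# * v        ≈⟨ +-cong (*-congˡ rz≈w) (trans qy≈v (sym (*-identityˡ v))) ⟨
        τ * cz R + cy Q       ∎)
      where
      qx≈u : cx Q ≈ u
      qx≈u = *-cancelˡ-nonZero τ≉0 (trans τqx≈0v+τu (0*u+v≈v v _))
      rx≈u : cx R ≈ u
      rx≈u = trans (sym (*-identityˡ _)) (trans 1rx≈0w+1u (trans (0*u+v≈v w _) (*-identityˡ u)))
      qy≈v : cy Q ≈ v
      qy≈v = *-cancelˡ-nonZero τ≉0 τqy≈τv
      rz≈w : cz R ≈ w
      rz≈w = trans (sym (*-identityˡ _)) (trans 1rz≈1w (*-identityˡ w))
    quotient : Conditions → LogarithmicAlong Q R (tyz τ)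
    quotient (qx≈rx , τqz+ry≈τrz+qy) = lin (cx R) (cy Q) (cz R) ,
      sym (zeroˡ _) , trans (*-congˡ qx≈rx) (sym (0*u+v≈v _ _)) , sym (0*u+v≈v _ _) , refl ,
      trans (+-congˡ (*-identityˡ _)) (trans τqz+ry≈τrz+qy (+-congˡ (sym (*-identityˡ _)))) , refl

  logarithmicAlong-x : ∀ Q R → LogarithmicAlong Q R X
  logarithmicAlong-x Q R = Equivalence.from (logarithmicAlong-x+by+cz⇔ Q R 0# 0#)
    (0*u≈0*v _ _ , +-cong (0*u≈0*v _ _) (0*u≈0*v _ _) , 0*u≈0*v _ _)

  logarithmicAlong-y : ∀ Q R → LogarithmicAlong Q R Y
  logarithmicAlong-y Q R = Q ,
    sym (zeroˡ _) , sym (0*u+v≈v _ _) , trans (0*u≈0*v _ _) (sym (0*u+v≈v _ _)) , refl ,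
    +-congˡ (0*u≈0*v _ _) , 0*u≈0*v _ _

  logarithmicAlong-z : ∀ Q R → LogarithmicAlong Q R Z
  logarithmicAlong-z Q R = R ,
    sym (zeroˡ _) , trans (0*u≈0*v _ _) (sym (0*u+v≈v _ _)) , sym (0*u+v≈v _ _) , 0*u≈0*v _ _ ,
    +-congʳ (0*u≈0*v _ _) , refl

  logarithmicAlong-x+y⇔ : ∀ Q R → LogarithmicAlong Q R (lin 1# 1# 0#) ⇔ ((cy Q ≈ cx Q) × (cz Q ≈ 0#))
  logarithmicAlong-x+y⇔ Q R = ⇔.trans (logarithmicAlong-x+by+cz⇔ Q R 1# 0#)
    (mk⇔ (λ (e₃ , e₄ , _) → Equivalence.to y² e₃ , Equivalence.to yz e₄)
         (λ (e₃ , e₄) → Equivalence.from y² e₃ , Equivalence.from yz e₄ , 0*u≈0*v _ _))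
    where
    y² : (1# * cy Q ≈ 1# * (1# * cx Q)) ⇔ (cy Q ≈ cx Q)
    y² = ≈-⇔ (*-identityˡ (cy Q)) (1*[1*u]≈u (cx Q))
    yz : (1# * cz Q + 0# * cy R ≈ 1# * (0# * cx R) + 0# * (1# * cx Q)) ⇔ (cz Q ≈ 0#)
    yz = ≈-⇔ (solve 2 (λ qz ry → con 1 :* qz :+ con 0 :* ry := qz) refl (cz Q) (cy R))
             (solve 2 (λ rx qx → con 1 :* (con 0 :* rx) :+ con 0 :* (con 1 :* qx) := con 0) refl (cx R) (cx Q))

  logarithmicAlong-x+y+z⇔ : ∀ Q R → LogarithmicAlong Q R (lin 1# 1# 1#) ⇔
    ((cy Q ≈ cx Q) × (cz Q + cy R ≈ cx R + cx Q) × (cz R ≈ cx R))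
  logarithmicAlong-x+y+z⇔ Q R = ⇔.trans (logarithmicAlong-x+by+cz⇔ Q R 1# 1#)
    (≈-⇔ (*-identityˡ _) (1*[1*u]≈u _) ×-⇔
     (≈-⇔ (+-cong (*-identityˡ _) (*-identityˡ _)) (+-cong (1*[1*u]≈u _) (1*[1*u]≈u _)) ×-⇔
      ≈-⇔ (*-identityˡ _) (1*[1*u]≈u _)))

  logarithmicAlong-x+z⇔ : ∀ Q R → LogarithmicAlong Q R (lin 1# 0# 1#) ⇔ ((cy R ≈ 0#) × (cz R ≈ cx R))
  logarithmicAlong-x+z⇔ Q R = ⇔.trans (logarithmicAlong-x+by+cz⇔ Q R 0# 1#)
    (mk⇔ (λ (_ , e₄ , e₅) → Equivalence.to yz e₄ , Equivalence.to z² e₅)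
         (λ (e₄ , e₅) → 0*u≈0*v _ _ , Equivalence.from yz e₄ , Equivalence.from z² e₅))
    where
    yz : (0# * cz Q + 1# * cy R ≈ 0# * (1# * cx R) + 1# * (0# * cx Q)) ⇔ (cy R ≈ 0#)
    yz = ≈-⇔ (solve 2 (λ qz ry → con 0 :* qz :+ con 1 :* ry := ry) refl (cz Q) (cy R))
             (solve 2 (λ rx qx → con 0 :* (con 1 :* rx) :+ con 1 :* (con 0 :* qx) := con 0) refl (cx R) (cx Q))
    z² : (1# * cz R ≈ 1# * (1# * cx R)) ⇔ (cz R ≈ cx R)
    z² = ≈-⇔ (*-identityˡ (cz R)) (1*[1*u]≈u (cx R))

  -- The arrangements

  x+y-and-τy+z⇒ : ∀ Q R τ → ¬ τ ≈ 0# →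
    LogarithmicAlong Q R (lin 1# 1# 0#) → LogarithmicAlong Q R (tyz τ) →
    (Q ≈L (cx Q ·L lin 1# 1# 0#)) × (cx R ≈ cx Q) × (cy R ≈ τ * cz R + cx Q)
  x+y-and-τy+z⇒ Q R τ τ≉0 along-x+y along-τy+z
    with Equivalence.to (logarithmicAlong-x+y⇔ Q R) along-x+y
       | Equivalence.to (logarithmicAlong-τy+z⇔ Q R τ τ≉0) along-τy+z
  ... | qy≈qx , qz≈0 | qx≈rx , τqz+ry≈τrz+qy =
    (x≈α⇒x≈α*1 refl , x≈α⇒x≈α*1 qy≈qx , x≈0⇒x≈α*0 _ qz≈0) , sym qx≈rx , (begin
      cy R             ≈⟨ +-identityˡ _ ⟨
      0# + cy R        ≈⟨ +-congʳ (trans (*-congˡ qz≈0) (zeroʳ τ)) ⟨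
      τ * cz Q + cy R  ≈⟨ τqz+ry≈τrz+qy ⟩
      τ * cz R + cy Q  ≈⟨ +-congˡ qy≈qx ⟩
      τ * cz R + cx Q  ∎)

  linesI⇒ : ∀ Q R τ σ → ¬ τ ≈ σ → ¬ τ ≈ 0# → ¬ σ ≈ 0# →
    LogarithmicAlong Q R (lin 1# 1# 0#) → LogarithmicAlong Q R (tyz τ) → LogarithmicAlong Q R (tyz σ) →
    ∃ λ α → (Q ≈L (α ·L lin 1# 1# 0#)) × (R ≈L (α ·L lin 1# 1# 0#))
  linesI⇒ Q R τ σ τ≉σ τ≉0 σ≉0 along-x+y along-τy+z along-σy+z
    with x+y-and-τy+z⇒ Q R τ τ≉0 along-x+y along-τy+z
       | x+y-and-τy+z⇒ Q R σ σ≉0 along-x+y along-σy+z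
  ... | Q≈ , rx≈qx , ry≈τrz+qx | _ , _ , ry≈σrz+qx =
    cx Q , Q≈ , x≈α⇒x≈α*1 rx≈qx , x≈α⇒x≈α*1 ry≈qx , x≈0⇒x≈α*0 _ rz≈0
    where
    rz≈0 : cz R ≈ 0#
    rz≈0 = distinct-cancel τ≉σ
      (+-cong (+-cancelʳ (cx Q) _ _ (trans (sym ry≈τrz+qx) ry≈σrz+qx))
              (trans (zeroʳ σ) (sym (zeroʳ τ))))
    ry≈qx : cy R ≈ cx Q
    ry≈qx = trans ry≈τrz+qx (trans (+-congʳ (trans (*-congˡ rz≈0) (zeroʳ τ))) (+-identityˡ _))

  linesI⇐ : ∀ Q R α → Q ≈L (α ·L lin 1# 1# 0#) → R ≈L (α ·L lin 1# 1# 0#) →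
    LogarithmicAlong Q R (lin 1# 1# 0#) × (∀ τ → ¬ τ ≈ 0# → LogarithmicAlong Q R (tyz τ))
  linesI⇐ Q R α Q≈Q₀ R≈Q₀ =
    logarithmicAlong-transport _ Q≈Q₀ R≈Q₀
      (Equivalence.from (logarithmicAlong-x+y⇔ Q₀ Q₀) (refl , zeroʳ α)) ,
    λ τ τ≉0 → logarithmicAlong-transport _ Q≈Q₀ R≈Q₀
                (Equivalence.from (logarithmicAlong-τy+z⇔ Q₀ Q₀ τ τ≉0) (refl , refl))
    where
    Q₀ : Lin
    Q₀ = α ·L lin 1# 1# 0#

  linesI₄⇒ : ∀ Q R τ → ¬ τ ≈ 0# → LogarithmicAlong Q R (lin 1# 1# 0#) → LogarithmicAlong Q R (tyz τ) →
    ∃₂ λ α β → (Q ≈L (α ·L lin 1# 1# 0#)) × (R ≈L ((α ·L lin 1# 1# 0#) +L (β ·L tyz τ)))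
  linesI₄⇒ Q R τ τ≉0 along-x+y along-τy+z with x+y-and-τy+z⇒ Q R τ τ≉0 along-x+y along-τy+z
  ... | Q≈ , rx≈qx , ry≈τrz+qx = cx Q , cz R , Q≈ ,
    trans rx≈qx (solve 2 (λ α β → α := α :* con 1 :+ β :* con 0) refl (cx Q) (cz R)) ,
    trans ry≈τrz+qx (solve 3 (λ τ α β → τ :* β :+ α := α :* con 1 :+ β :* τ) refl τ (cx Q) (cz R)) ,
    solve 2 (λ α β → β := α :* con 0 :+ β :* con 1) refl (cx Q) (cz R)

  linesI₄⇐ : ∀ Q R τ α β → ¬ τ ≈ 0# →
    Q ≈L (α ·L lin 1# 1# 0#) → R ≈L ((α ·L lin 1# 1# 0#) +L (β ·L tyz τ)) →
    LogarithmicAlong Q R (lin 1# 1# 0#) × LogarithmicAlong Q R (tyz τ)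
  linesI₄⇐ Q R τ α β τ≉0 Q≈Q₀ R≈R₀ =
    logarithmicAlong-transport _ Q≈Q₀ R≈R₀
      (Equivalence.from (logarithmicAlong-x+y⇔ Q₀ R₀) (refl , zeroʳ α)) ,
    logarithmicAlong-transport _ Q≈Q₀ R≈R₀ (Equivalence.from (logarithmicAlong-τy+z⇔ Q₀ R₀ τ τ≉0)
      (solve 2 (λ α β → α :* con 1 := α :* con 1 :+ β :* con 0) refl α β ,
       solve 3 (λ τ α β → τ :* (α :* con 0) :+ (α :* con 1 :+ β :* τ)
                          := τ :* (α :* con 0 :+ β :* con 1) :+ α :* con 1) refl τ α β))
    where
    Q₀ R₀ : Lin
    Q₀ = α ·L lin 1# 1# 0#
    R₀ = (α ·L lin 1# 1# 0#) +L (β ·L tyz τ)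

  linesII⇒ : ∀ Q R τ → ¬ τ ≈ 0# → ¬ τ ≈ 1# → LogarithmicAlong Q R (lin 1# 1# 1#) →
    LogarithmicAlong Q R (tyz τ) → ∃ λ α → (Q ≈L (α ·L lin 1# 1# 1#)) × (R ≈L (α ·L lin 1# 1# 1#))
  linesII⇒ Q R τ τ≉0 τ≉1 along-x+y+z along-τy+z
    with Equivalence.to (logarithmicAlong-x+y+z⇔ Q R) along-x+y+z
       | Equivalence.to (logarithmicAlong-τy+z⇔ Q R τ τ≉0) along-τy+z
  ... | qy≈qx , qz+ry≈rx+qx , rz≈rx | qx≈rx , τqz+ry≈τrz+qy =
    cx Q , (x≈α⇒x≈α*1 refl , x≈α⇒x≈α*1 qy≈qx , x≈α⇒x≈α*1 qz≈qx) ,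
           (x≈α⇒x≈α*1 (sym qx≈rx) , x≈α⇒x≈α*1 ry≈qx , x≈α⇒x≈α*1 (trans rz≈rx (sym qx≈rx)))
    where
    qz+ry≈qx+qx : cz Q + cy R ≈ cx Q + cx Q
    qz+ry≈qx+qx = trans qz+ry≈rx+qx (+-congʳ (sym qx≈rx))
    τqz+ry≈τqx+qx : τ * cz Q + cy R ≈ τ * cx Q + cx Q
    τqz+ry≈τqx+qx = trans τqz+ry≈τrz+qy (+-cong (*-congˡ (trans rz≈rx (sym qx≈rx))) qy≈qx)
    qz≈qx : cz Q ≈ cx Q
    qz≈qx = distinct-cancel τ≉1 (+-cancelʳ (cy R) _ _ (begin
      τ * cz Q + 1# * cx Q + cy R  ≈⟨ solve 4 (λ τ z x y → τ :* z :+ con 1 :* x :+ y := τ :* z :+ y :+ x)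
                                             refl τ (cz Q) (cx Q) (cy R) ⟩
      τ * cz Q + cy R + cx Q       ≈⟨ +-congʳ τqz+ry≈τqx+qx ⟩
      τ * cx Q + cx Q + cx Q       ≈⟨ solve 2 (λ τ x → τ :* x :+ x :+ x := x :+ x :+ τ :* x) refl τ (cx Q) ⟩
      cx Q + cx Q + τ * cx Q       ≈⟨ +-congʳ qz+ry≈qx+qx ⟨
      cz Q + cy R + τ * cx Q       ≈⟨ solve 4 (λ τ z x y → z :+ y :+ τ :* x := con 1 :* z :+ τ :* x :+ y)
                                             refl τ (cz Q) (cx Q) (cy R) ⟩
      1# * cz Q + τ * cx Q + cy R  ∎))
    ry≈qx : cy R ≈ cx Q
    ry≈qx = +-cancelˡ (cx Q) _ _ (trans (+-congʳ (sym qz≈qx)) qz+ry≈qx+qx)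

  linesII⇐ : ∀ Q R α → Q ≈L (α ·L lin 1# 1# 1#) → R ≈L (α ·L lin 1# 1# 1#) →
    LogarithmicAlong Q R (lin 1# 1# 1#) × (∀ τ → ¬ τ ≈ 0# → LogarithmicAlong Q R (tyz τ))
  linesII⇐ Q R α Q≈Q₀ R≈Q₀ =
    logarithmicAlong-transport _ Q≈Q₀ R≈Q₀
      (Equivalence.from (logarithmicAlong-x+y+z⇔ Q₀ Q₀) (refl , refl , refl)) ,
    λ τ τ≉0 → logarithmicAlong-transport _ Q≈Q₀ R≈Q₀
                (Equivalence.from (logarithmicAlong-τy+z⇔ Q₀ Q₀ τ τ≉0) (refl , refl))
    where
    Q₀ : Lin
    Q₀ = α ·L lin 1# 1# 1#

  linesIII⇒ : ∀ Q R → LogarithmicAlong Q R (lin 1# 1# 1#) → LogarithmicAlong Q R (lin 1# 0# 1#) →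
    LogarithmicAlong Q R (tyz 1#) → ∃ λ α → (Q ≈L (α ·L lin 1# 1# (1# + 1#))) × (R ≈L (α ·L lin 1# 0# 1#))
  linesIII⇒ Q R along-x+y+z along-x+z along-y+z
    with Equivalence.to (logarithmicAlong-x+y+z⇔ Q R) along-x+y+z
       | Equivalence.to (logarithmicAlong-x+z⇔ Q R) along-x+z
       | Equivalence.to (logarithmicAlong-τy+z⇔ Q R 1# 1≉0) along-y+z
  ... | qy≈qx , qz+ry≈rx+qx , rz≈rx | ry≈0 , _ | qx≈rx , _ =
    cx Q , (x≈α⇒x≈α*1 refl , x≈α⇒x≈α*1 qy≈qx , qz≈2qx) ,
           (x≈α⇒x≈α*1 (sym qx≈rx) , x≈0⇒x≈α*0 _ ry≈0 , x≈α⇒x≈α*1 (trans rz≈rx (sym qx≈rx)))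
    where
    qz≈2qx : cz Q ≈ cx Q * (1# + 1#)
    qz≈2qx = begin
      cz Q              ≈⟨ +-identityʳ _ ⟨
      cz Q + 0#         ≈⟨ +-congˡ ry≈0 ⟨
      cz Q + cy R       ≈⟨ qz+ry≈rx+qx ⟩
      cx R + cx Q       ≈⟨ +-congʳ qx≈rx ⟨
      cx Q + cx Q       ≈⟨ solve 1 (λ x → x :+ x := x :* (con 1 :+ con 1)) refl (cx Q) ⟩
      cx Q * (1# + 1#)  ∎

  linesIII⇐ : ∀ Q R α → Q ≈L (α ·L lin 1# 1# (1# + 1#)) → R ≈L (α ·L lin 1# 0# 1#) →
    LogarithmicAlong Q R (lin 1# 1# 1#) × LogarithmicAlong Q R (lin 1# 0# 1#) × LogarithmicAlong Q R (tyz 1#)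
  linesIII⇐ Q R α Q≈Q₀ R≈R₀ =
    logarithmicAlong-transport _ Q≈Q₀ R≈R₀ (Equivalence.from (logarithmicAlong-x+y+z⇔ Q₀ R₀)
      (refl , solve 1 (λ α → α :* (con 1 :+ con 1) :+ α :* con 0 := α :* con 1 :+ α :* con 1) refl α , refl)) ,
    logarithmicAlong-transport _ Q≈Q₀ R≈R₀
      (Equivalence.from (logarithmicAlong-x+z⇔ Q₀ R₀) (zeroʳ α , refl)) ,
    logarithmicAlong-transport _ Q≈Q₀ R≈R₀ (Equivalence.from (logarithmicAlong-τy+z⇔ Q₀ R₀ 1# 1≉0)
      (refl , solve 1 (λ α → con 1 :* (α :* (con 1 :+ con 1)) :+ α :* con 0
                             := con 1 :* (α :* con 1) :+ α :* con 1) refl α))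
    where
    Q₀ R₀ : Lin
    Q₀ = α ·L lin 1# 1# (1# + 1#)
    R₀ = α ·L lin 1# 0# 1#

  isLogarithmic-xyz⇔ : ∀ Q R A → IsLogarithmic (θyz Q R) (X ∷ Y ∷ Z ∷ A) ⇔ All (LogarithmicAlong Q R) A
  isLogarithmic-xyz⇔ Q R A = ⇔.trans (isLogarithmic⇔ Q R _)
    (mk⇔ (λ { (_ ∷ _ ∷ _ ∷ along-A) → along-A })
         (λ along-A → logarithmicAlong-x Q R ∷ logarithmicAlong-y Q R ∷ logarithmicAlong-z Q R ∷ along-A))

  isLogarithmic-pencil⇔ : ∀ Q R L {n} (τ : Fin n → Carrier) →
    IsLogarithmic (θyz Q R) (X ∷ Y ∷ Z ∷ L ∷ map (λ j → tyz (τ j)) (allFin n)) ⇔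
    (LogarithmicAlong Q R L × (∀ j → LogarithmicAlong Q R (tyz (τ j))))
  isLogarithmic-pencil⇔ Q R L τ = ⇔.trans (isLogarithmic-xyz⇔ Q R _) (All-∷-map-allFin⇔ L _)

  isLogarithmic-arrI⇔ : (s : ℕ) → 5 ≤ s → (t : Fin (s ∸ 3) → Carrier) →
    (∀ i j → t i ≈ t j → i ≡ j) → (∀ i → ¬ (t i ≈ 0#)) →
    ∀ Q R → IsLogarithmic (θyz Q R) (arrI s t) ⇔
      ∃ λ α → (Q ≈L (α ·L lin 1# 1# 0#)) × (R ≈L (α ·L lin 1# 1# 0#))
  isLogarithmic-arrI⇔ (suc (suc (suc (suc (suc n))))) (s≤s (s≤s (s≤s (s≤s (s≤s z≤n)))))
                      t t-injective t≉0 Q R =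
    ⇔.trans (isLogarithmic-pencil⇔ Q R (lin 1# 1# 0#) t) (mk⇔
      (λ (along-x+y , along-t) → linesI⇒ Q R (t Fin.zero) (t (Fin.suc Fin.zero)) t₀≉t₁ (t≉0 _) (t≉0 _)
                                   along-x+y (along-t _) (along-t _))
      (λ (α , Q≈ , R≈) → let (along-x+y , along-τy+z) = linesI⇐ Q R α Q≈ R≈
                         in along-x+y , λ j → along-τy+z (t j) (t≉0 j)))
    where
    t₀≉t₁ : ¬ t Fin.zero ≈ t (Fin.suc Fin.zero)
    t₀≉t₁ t₀≈t₁ = 0≢1+n (t-injective _ _ t₀≈t₁)

  isLogarithmic-arrI₄⇔ : (t : Fin (4 ∸ 3) → Carrier) → (∀ i → ¬ (t i ≈ 0#)) →
    ∀ Q R → IsLogarithmic (θyz Q R) (arrI 4 t) ⇔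
      ∃₂ λ α β → (Q ≈L (α ·L lin 1# 1# 0#)) × (R ≈L ((α ·L lin 1# 1# 0#) +L (β ·L tyz (t Fin.zero))))
  isLogarithmic-arrI₄⇔ t t≉0 Q R = ⇔.trans (isLogarithmic-pencil⇔ Q R (lin 1# 1# 0#) t) (mk⇔
    (λ (along-x+y , along-t) → linesI₄⇒ Q R (t Fin.zero) (t≉0 _) along-x+y (along-t _))
    (λ (α , β , Q≈ , R≈) → let (along-x+y , along-τy+z) = linesI₄⇐ Q R (t Fin.zero) α β (t≉0 _) Q≈ R≈
                           in along-x+y , λ { Fin.zero → along-τy+z }))

  -- A single line t y + z with t ≠ 0, 1 already forces the solution.
  isLogarithmic-arrII⇔ : (s : ℕ) → 4 ≤ s → (t : Fin (s ∸ 3) → Carrier) →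
    (∀ i j → t i ≈ t j → i ≡ j) → (∀ i → ¬ (t i ≈ 0#)) → (∀ i → ¬ (t i ≈ 1#)) →
    ∀ Q R → IsLogarithmic (θyz Q R) (arrII s t) ⇔
      ∃ λ α → (Q ≈L (α ·L lin 1# 1# 1#)) × (R ≈L (α ·L lin 1# 1# 1#))
  isLogarithmic-arrII⇔ (suc (suc (suc (suc n)))) (s≤s (s≤s (s≤s (s≤s z≤n)))) t _ t≉0 t≉1 Q R =
    ⇔.trans (isLogarithmic-pencil⇔ Q R (lin 1# 1# 1#) t) (mk⇔
      (λ (along-x+y+z , along-t) → linesII⇒ Q R (t Fin.zero) (t≉0 _) (t≉1 _) along-x+y+z (along-t _))
      (λ (α , Q≈ , R≈) → let (along-x+y+z , along-τy+z) = linesII⇐ Q R α Q≈ R≈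
                         in along-x+y+z , λ j → along-τy+z (t j) (t≉0 j)))

  isLogarithmic-arrIII⇔ : ∀ Q R → IsLogarithmic (θyz Q R) arrIII ⇔
    ∃ λ α → (Q ≈L (α ·L lin 1# 1# (1# + 1#))) × (R ≈L (α ·L lin 1# 0# 1#))
  isLogarithmic-arrIII⇔ Q R = ⇔.trans (isLogarithmic-xyz⇔ Q R _) (mk⇔
    (λ { (along-x+y+z ∷ along-x+z ∷ along-y+z ∷ []) → linesIII⇒ Q R along-x+y+z along-x+z along-y+z })
    (λ (α , Q≈ , R≈) → let (along-x+y+z , along-x+z , along-y+z) = linesIII⇐ Q R α Q≈ R≈
                       in along-x+y+z ∷ along-x+z ∷ along-y+z ∷ []))

corollary3p3 : {c ℓ : Level} (𝔽 : Field c ℓ) → Over.CharZero 𝔽 →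
  let open Field 𝔽 in let open Over 𝔽 in
  -- (I), s ≥ 5
  ((s : ℕ) → 5 ≤ s → (t : Fin (s Data.Nat.∸ 3) → Carrier) →
    (∀ i j → t i ≈ t j → i ≡ j) → (∀ i → ¬ (t i ≈ 0#)) →
    ∀ Q' R' → IsLogarithmic (θyz Q' R') (arrI s t) ⇔
      ∃ λ α → (Q' ≈L (α ·L lin 1# 1# 0#)) × (R' ≈L (α ·L lin 1# 1# 0#)))
  ×
  -- (I), s = 4
  ((t : Fin (4 Data.Nat.∸ 3) → Carrier) → (∀ i → ¬ (t i ≈ 0#)) →
    ∀ Q' R' → IsLogarithmic (θyz Q' R') (arrI 4 t) ⇔
      ∃₂ λ α β → (Q' ≈L (α ·L lin 1# 1# 0#)) ×
                 (R' ≈L ((α ·L lin 1# 1# 0#) +L (β ·L tyz (t Data.Fin.zero)))))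
  ×
  -- (II), s ≥ 4
  ((s : ℕ) → 4 ≤ s → (t : Fin (s Data.Nat.∸ 3) → Carrier) →
    (∀ i j → t i ≈ t j → i ≡ j) → (∀ i → ¬ (t i ≈ 0#)) → (∀ i → ¬ (t i ≈ 1#)) →
    ∀ Q' R' → IsLogarithmic (θyz Q' R') (arrII s t) ⇔
      ∃ λ α → (Q' ≈L (α ·L lin 1# 1# 1#)) × (R' ≈L (α ·L lin 1# 1# 1#)))
  ×
  -- (III)
  (∀ Q' R' → IsLogarithmic (θyz Q' R') arrIII ⇔
      ∃ λ α → (Q' ≈L (α ·L lin 1# 1# (1# + 1#))) × (R' ≈L (α ·L lin 1# 0# 1#)))
corollary3p3 𝔽 _ =
  isLogarithmic-arrI⇔ , isLogarithmic-arrI₄⇔ , isLogarithmic-arrII⇔ , isLogarithmic-arrIII⇔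
  where open LineArrangements 𝔽
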